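{- Let $G$ be a finite simple graph with parameters $(r_2,r_3)$ and let $e\in E(G)$ be an edge with $K_3\deg(e)=k$. Then \[ 2r_3 \le (r_2-k-1)(r_2-2) + k(k+1). \]
   Context: For a vertex $v$, $K_3\deg(v)$ is the number of triangles of $G$ containing $v$; for an edge $uv$, $K_3\deg(uv)$ is the number of triangles containing $uv$, i.e. $|N(u)\cap N(v)|$. A graph has parameters $(r_2,r_3)$ if every vertex has degree $r_2$ and every vertex has $K_3$-degree $r_3$. -}

module Defs where

open import Data.Nat using (ℕ; _<_)
open import Data.Nat.Properties using (_<?_)
open import Data.Bool using (Bool; true; false; _∧_)
open import Data.Fin using (Fin; toℕ)
open import Data.List using (List; length; filter; allFin; concatMap; map)
open import Data.Product using (_×_; _,_; proj₁; proj₂)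
open import Relation.Binary.PropositionalEquality using (_≡_)
open import Relation.Nullary using (¬_)
open import Relation.Nullary.Decidable using (Dec; yes; no)
open import Relation.Unary using (Decidable)

record SimpleGraph (n : ℕ) : Set where
  field
    adj       : Fin n → Fin n → Bool
    adj-sym   : ∀ u v → adj u v ≡ adj v u
    adj-irrfl : ∀ v → adj v v ≡ false

open SimpleGraph public

isTrue : (b : Bool) → Dec (b ≡ true)
isTrue true  = yes _≡_.refl
isTrue false = no (λ ())

Adj : ∀ {n} → SimpleGraph n → Fin n → Fin n → Set
Adj G u v = adj G u v ≡ true

deg : ∀ {n} → SimpleGraph n → Fin n → ℕ
deg {n} G v = length (filter (λ u → isTrue (adj G v u)) (allFin n))

-- unordered pairs {u, w} of distinct vertices, represented with toℕ u < toℕ w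
pairs : (n : ℕ) → List (Fin n × Fin n)
pairs n = filter (λ p → toℕ (proj₁ p) <? toℕ (proj₂ p))
                 (concatMap (λ u → map (λ w → (u , w)) (allFin n)) (allFin n))

K3deg : ∀ {n} → SimpleGraph n → Fin n → ℕ
K3deg {n} G v =
  length (filter (λ p → isTrue (adj G v (proj₁ p) ∧ adj G v (proj₂ p)
                                ∧ adj G (proj₁ p) (proj₂ p)))
                 (pairs n))

K3degE : ∀ {n} → SimpleGraph n → Fin n → Fin n → ℕ
K3degE {n} G u v = length (filter (λ w → isTrue (adj G u w ∧ adj G v w)) (allFin n))

HasParams : ∀ {n} → SimpleGraph n → ℕ → ℕ → Set
HasParams {n} G r₂ r₃ = ∀ (v : Fin n) → (deg G v ≡ r₂) × (K3deg G v ≡ r₃)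

-- Count 2r₃ = Σ_{y,z ∈ N(x)} [y ~ z] at both ends x = u, v of the edge and add the two counts.
-- Write N(u) = A ∪ P and N(v) = A ∪ Q with A = N(u) ∩ N(v), P = N(u) ∖ N(v) ∋ v, Q = N(v) ∖ N(u) ∋ u,
-- and ⟨f, g⟩ for the number of adjacent pairs weighted by f and g. Then
--   4r₃ = ⟨A+P, A+P⟩ + ⟨A+Q, A+Q⟩ = 2⟨A, A+P+Q⟩ + ⟨P, P⟩ + ⟨Q, Q⟩.
-- Since A, P, Q are disjoint, ⟨A, A+P+Q⟩ ≤ Σ_{y ∈ A} deg y = k r₂, and since v is isolated in P,
-- ⟨P, P⟩ ≤ m(m−1) with m = |P ∖ {v}| = r₂ − k − 1; likewise for Q. Hence 2r₃ ≤ k r₂ + m(m−1),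
-- which is the claimed bound rewritten.
module Submission where

open import Defs

module TriangleCounting where
  open import Data.Bool using (Bool; true; false; _∧_; not)
  open import Data.Bool.Properties using (∧-comm)
  open import Data.Fin using (Fin; toℕ; punchIn) renaming (zero to fzero; suc to fsuc)
  open import Data.Fin.Properties using (toℕ-injective) renaming (_≟_ to _≟ᶠ_)
  open import Data.List using (List; []; _∷_; _++_; length; filter; tabulate; concatMap; map)
  open import Data.List.Properties using (filter-++; length-++; map-tabulate)
  open import Data.Nat using (ℕ; zero; suc; _+_; _*_; _∸_; _≤_; _<_; z≤n; s≤s)
  open import Data.Nat.Properties
  open import Data.Product using (_×_; _,_; proj₁; proj₂; Σ-syntax)
  open import Data.Nat.Tactic.RingSolver using (solve-∀)
  open import Function using (_∘_)
  open import Algebra.Properties.CommutativeSemigroup *-commutativeSemigroup using (x∙yz≈y∙xz)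
  open import Relation.Binary using (tri<; tri≈; tri>)
  open import Relation.Binary.PropositionalEquality
  open import Relation.Nullary using (Dec; does; yes; no; _×-dec_)
  open import Relation.Nullary.Decidable using (dec-true; dec-false)
  open import Relation.Unary using (Pred; Decidable)
  open import Algebra.Properties.Semiring.Sum +-*-semiring
    using (sum; sum-syntax; sum-cong-≗; sum-remove; sum-replicate-zero; ∑-distrib-+; ∑-comm; *-distribˡ-sum; *-distribʳ-sum)

  χ : Bool → ℕ
  χ true  = 1
  χ false = 0

  χ-∧ : ∀ a b → χ (a ∧ b) ≡ χ a * χ b
  χ-∧ true  b = sym (*-identityˡ (χ b))
  χ-∧ false b = refl

  χ-isTrue : ∀ b → χ (does (isTrue b)) ≡ χ b
  χ-isTrue true  = refl
  χ-isTrue false = refl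

  ∑-mono : ∀ {n} {f g : Fin n → ℕ} → (∀ i → f i ≤ g i) → sum f ≤ sum g
  ∑-mono {zero}  f≤g = z≤n
  ∑-mono {suc n} f≤g = +-mono-≤ (f≤g fzero) (∑-mono (f≤g ∘ fsuc))

  ∑-mono-except : ∀ {n} (f g : Fin n → ℕ) i → g i ≡ 0 → (∀ j → g j ≤ f j) → sum g ≤ sum f ∸ f i
  ∑-mono-except {suc n} f g i gᵢ≡0 g≤f = begin
    sum g                                  ≡⟨ sum-remove {n} {i} g ⟩
    g i + sum (g ∘ punchIn i)              ≡⟨ cong (_+ sum (g ∘ punchIn i)) gᵢ≡0 ⟩
    sum (g ∘ punchIn i)                    ≤⟨ ∑-mono (g≤f ∘ punchIn i) ⟩
    sum (f ∘ punchIn i)                    ≡⟨ m+n∸m≡n (f i) _ ⟨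
    f i + sum (f ∘ punchIn i) ∸ f i        ≡⟨ cong (_∸ f i) (sum-remove {n} {i} f) ⟨
    sum f ∸ f i                            ∎
    where open ≤-Reasoning

  ∑-δ : ∀ {n} (j : Fin n) → ∑[ i < n ] χ (does (i ≟ᶠ j)) ≡ 1
  ∑-δ {suc n} fzero    = cong suc (sum-replicate-zero n)
  ∑-δ {suc n} (fsuc j) = ∑-δ j

  module _ {a p} {A : Set a} {P : Pred A p} (P? : Decidable P) where

    length-filter-tabulate : ∀ {n} (f : Fin n → A) →
      length (filter P? (tabulate f)) ≡ ∑[ i < n ] χ (does (P? (f i)))
    length-filter-tabulate {zero}  f = refl
    length-filter-tabulate {suc n} f with does (P? (f fzero))
    ... | true  = cong suc (length-filter-tabulate (f ∘ fsuc))
    ... | false = length-filter-tabulate (f ∘ fsuc)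

    length-filter-concatMap : ∀ {b} {B : Set b} {n} (g : B → List A) (f : Fin n → B) →
      length (filter P? (concatMap g (tabulate f))) ≡ ∑[ i < n ] length (filter P? (g (f i)))
    length-filter-concatMap {n = zero}  g f = refl
    length-filter-concatMap {n = suc n} g f = begin
      length (filter P? (g (f fzero) ++ concatMap g (tabulate (f ∘ fsuc))))
        ≡⟨ cong length (filter-++ P? (g (f fzero)) _) ⟩
      length (filter P? (g (f fzero)) ++ filter P? (concatMap g (tabulate (f ∘ fsuc))))
        ≡⟨ length-++ (filter P? (g (f fzero))) ⟩
      length (filter P? (g (f fzero))) + length (filter P? (concatMap g (tabulate (f ∘ fsuc))))
        ≡⟨ cong (length (filter P? (g (f fzero))) +_) (length-filter-concatMap g (f ∘ fsuc)) ⟩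
      ∑[ i < suc n ] length (filter P? (g (f i)))   ∎
      where open ≡-Reasoning

    length-filter-filter : ∀ {q} {Q : Pred A q} (Q? : Decidable Q) xs →
      length (filter Q? (filter P? xs)) ≡ length (filter (λ x → P? x ×-dec Q? x) xs)
    length-filter-filter Q? []       = refl
    length-filter-filter Q? (x ∷ xs) with does (P? x)
    ... | false = length-filter-filter Q? xs
    ... | true with does (Q? x)
    ...   | true  = cong suc (length-filter-filter Q? xs)
    ...   | false = length-filter-filter Q? xs

  ∑∑-distrib-+ : ∀ {m n} (f g : Fin m → Fin n → ℕ) →
    ∑[ i < m ] ∑[ j < n ] (f i j + g i j) ≡ ∑[ i < m ] ∑[ j < n ] f i j + ∑[ i < m ] ∑[ j < n ] g i j
  ∑∑-distrib-+ f g = trans (sum-cong-≗ λ i → ∑-distrib-+ (f i) (g i)) (∑-distrib-+ (λ i → sum (f i)) (λ i → sum (g i)))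

  lt : ∀ {n} → Fin n → Fin n → Bool
  lt i j = does (toℕ i <? toℕ j)

  lt-split : ∀ {n} (f : Fin n → Fin n → ℕ) → (∀ i j → f i j ≡ f j i) → (∀ i → f i i ≡ 0) →
    ∀ i j → f i j ≡ χ (lt i j) * f i j + χ (lt j i) * f j i
  lt-split f f-sym f-diag i j with <-cmp (toℕ i) (toℕ j)
  ... | tri< i<j _ j≮i rewrite dec-true (toℕ i <? toℕ j) i<j | dec-false (toℕ j <? toℕ i) j≮i =
    sym (trans (+-identityʳ _) (+-identityʳ _))
  ... | tri> i≮j _ j<i rewrite dec-false (toℕ i <? toℕ j) i≮j | dec-true (toℕ j <? toℕ i) j<i =
    trans (f-sym i j) (sym (+-identityʳ _))
  ... | tri≈ _ i≡j _ rewrite toℕ-injective i≡j | f-diag j | *-zeroʳ (χ (lt j j)) = refl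

  ∑∑-symmetric : ∀ {n} (f : Fin n → Fin n → ℕ) → (∀ i j → f i j ≡ f j i) → (∀ i → f i i ≡ 0) →
    ∑[ i < n ] ∑[ j < n ] f i j ≡ 2 * ∑[ i < n ] ∑[ j < n ] (χ (lt i j) * f i j)
  ∑∑-symmetric {n} f f-sym f-diag = begin
    ∑[ i < n ] ∑[ j < n ] f i j
      ≡⟨ sum-cong-≗ (λ i → sum-cong-≗ (lt-split f f-sym f-diag i)) ⟩
    ∑[ i < n ] ∑[ j < n ] (χ (lt i j) * f i j + χ (lt j i) * f j i)
      ≡⟨ ∑∑-distrib-+ (λ i j → χ (lt i j) * f i j) (λ i j → χ (lt j i) * f j i) ⟩
    S + ∑[ i < n ] ∑[ j < n ] (χ (lt j i) * f j i)
      ≡⟨ cong (S +_) (∑-comm (λ i j → χ (lt j i) * f j i)) ⟩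
    S + S
      ≡⟨ cong (S +_) (+-identityʳ S) ⟨
    2 * S ∎
    where
    open ≡-Reasoning
    S : ℕ
    S = ∑[ i < n ] ∑[ j < n ] (χ (lt i j) * f i j)

  χ≤1 : ∀ b → χ b ≤ 1
  χ≤1 true  = ≤-refl
  χ≤1 false = z≤n

  *-χ-≤ : ∀ m b → m * χ b ≤ m
  *-χ-≤ m b = ≤-trans (*-monoʳ-≤ m (χ≤1 b)) (≤-reflexive (*-identityʳ m))

  *-∸-≤ : ∀ m s → m * (s ∸ m) ≤ m * (s ∸ 1)
  *-∸-≤ zero    s = z≤n
  *-∸-≤ (suc m) s = *-monoʳ-≤ (suc m) (∸-monoʳ-≤ s (s≤s z≤n))

  module _ {n} (G : SimpleGraph n) where

    adjℕ : Fin n → Fin n → ℕ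
    adjℕ y z = χ (adj G y z)

    adjℕ-sym : ∀ y z → adjℕ y z ≡ adjℕ z y
    adjℕ-sym y z = cong χ (adj-sym G y z)

    adjℕ-irrefl : ∀ y → adjℕ y y ≡ 0
    adjℕ-irrefl y = cong χ (adj-irrfl G y)

    deg≡∑ : ∀ x → deg G x ≡ ∑[ y < n ] adjℕ x y
    deg≡∑ x = trans (length-filter-tabulate (λ y → isTrue (adj G x y)) (λ y → y))
                    (sum-cong-≗ (λ y → χ-isTrue (adj G x y)))

    K3deg≡∑ : ∀ x → K3deg G x ≡ ∑[ y < n ] ∑[ z < n ] (χ (lt y z) * (adjℕ x y * (adjℕ x z * adjℕ y z)))
    K3deg≡∑ x = begin
      K3deg G x
        ≡⟨ length-filter-filter L? T? (concatMap row (tabulate (λ y → y))) ⟩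
      length (filter LT? (concatMap row (tabulate (λ y → y))))
        ≡⟨ length-filter-concatMap LT? row (λ y → y) ⟩
      ∑[ y < n ] length (filter LT? (row y))
        ≡⟨ sum-cong-≗ (λ y → cong (length ∘ filter LT?) (map-tabulate (λ z → z) (y ,_))) ⟩
      ∑[ y < n ] length (filter LT? (tabulate (y ,_)))
        ≡⟨ sum-cong-≗ (λ y → length-filter-tabulate LT? (y ,_)) ⟩
      ∑[ y < n ] ∑[ z < n ] χ (lt y z ∧ does (isTrue (adj G x y ∧ adj G x z ∧ adj G y z)))
        ≡⟨ sum-cong-≗ (λ y → sum-cong-≗ (λ z → χ-triangle y z)) ⟩
      ∑[ y < n ] ∑[ z < n ] (χ (lt y z) * (adjℕ x y * (adjℕ x z * adjℕ y z))) ∎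
      where
      open ≡-Reasoning
      row : Fin n → List (Fin n × Fin n)
      row y = map (y ,_) (tabulate (λ z → z))
      triangle : Fin n × Fin n → Bool
      triangle (y , z) = adj G x y ∧ adj G x z ∧ adj G y z
      L? : (p : Fin n × Fin n) → Dec (toℕ (proj₁ p) < toℕ (proj₂ p))
      L? (y , z) = toℕ y <? toℕ z
      T? : (p : Fin n × Fin n) → Dec (triangle p ≡ true)
      T? p = isTrue (triangle p)
      LT? : (p : Fin n × Fin n) → Dec (toℕ (proj₁ p) < toℕ (proj₂ p) × triangle p ≡ true)
      LT? p = L? p ×-dec T? p
      χ-triangle : ∀ y z → χ (lt y z ∧ does (isTrue (adj G x y ∧ adj G x z ∧ adj G y z)))
                         ≡ χ (lt y z) * (adjℕ x y * (adjℕ x z * adjℕ y z))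
      χ-triangle y z = begin
        χ (lt y z ∧ does (isTrue (adj G x y ∧ adj G x z ∧ adj G y z)))
          ≡⟨ χ-∧ (lt y z) _ ⟩
        χ (lt y z) * χ (does (isTrue (adj G x y ∧ adj G x z ∧ adj G y z)))
          ≡⟨ cong (χ (lt y z) *_) (χ-isTrue _) ⟩
        χ (lt y z) * χ (adj G x y ∧ adj G x z ∧ adj G y z)
          ≡⟨ cong (χ (lt y z) *_) (trans (χ-∧ (adj G x y) _) (cong (adjℕ x y *_) (χ-∧ (adj G x z) _))) ⟩
        χ (lt y z) * (adjℕ x y * (adjℕ x z * adjℕ y z)) ∎

    pairing : (Fin n → ℕ) → (Fin n → ℕ) → ℕ
    pairing f g = ∑[ y < n ] ∑[ z < n ] (f y * (g z * adjℕ y z))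

    pairing-cong : ∀ {f f′ g g′} → (∀ y → f y ≡ f′ y) → (∀ z → g z ≡ g′ z) → pairing f g ≡ pairing f′ g′
    pairing-cong f≗f′ g≗g′ = sum-cong-≗ λ y → sum-cong-≗ λ z →
      cong₂ (λ a b → a * (b * adjℕ y z)) (f≗f′ y) (g≗g′ z)

    pairing-comm : ∀ f g → pairing f g ≡ pairing g f
    pairing-comm f g = trans (∑-comm (λ y z → f y * (g z * adjℕ y z))) (sum-cong-≗ λ z → sum-cong-≗ λ y →
      trans (x∙yz≈y∙xz (f y) (g z) (adjℕ y z)) (cong (λ e → g z * (f y * e)) (adjℕ-sym y z)))

    pairing-distribʳ : ∀ f g h → pairing f (λ z → g z + h z) ≡ pairing f g + pairing f h
    pairing-distribʳ f g h = trans (sum-cong-≗ λ y → sum-cong-≗ λ z →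
        trans (cong (f y *_) (*-distribʳ-+ (adjℕ y z) (g z) (h z))) (*-distribˡ-+ (f y) _ _))
      (∑∑-distrib-+ (λ y z → f y * (g z * adjℕ y z)) (λ y z → f y * (h z * adjℕ y z)))

    pairing-distribˡ : ∀ f g h → pairing (λ y → f y + g y) h ≡ pairing f h + pairing g h
    pairing-distribˡ f g h = begin
      pairing (λ y → f y + g y) h   ≡⟨ pairing-comm (λ y → f y + g y) h ⟩
      pairing h (λ y → f y + g y)   ≡⟨ pairing-distribʳ h f g ⟩
      pairing h f + pairing h g     ≡⟨ cong₂ _+_ (pairing-comm h f) (pairing-comm h g) ⟩
      pairing f h + pairing g h     ∎
      where open ≡-Reasoning

    pairing-square : ∀ f g → pairing (λ y → f y + g y) (λ y → f y + g y) ≡ pairing f f + 2 * pairing f g + pairing g g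
    pairing-square f g = begin
      pairing (λ y → f y + g y) (λ y → f y + g y)
        ≡⟨ pairing-distribˡ f g (λ y → f y + g y) ⟩
      pairing f (λ y → f y + g y) + pairing g (λ y → f y + g y)
        ≡⟨ cong₂ _+_ (pairing-distribʳ f f g) (pairing-distribʳ g f g) ⟩
      pairing f f + pairing f g + (pairing g f + pairing g g)
        ≡⟨ cong (λ t → pairing f f + pairing f g + (t + pairing g g)) (pairing-comm g f) ⟩
      pairing f f + pairing f g + (pairing f g + pairing g g)
        ≡⟨ regroup (pairing f f) (pairing f g) (pairing g g) ⟩
      pairing f f + 2 * pairing f g + pairing g g ∎
      where
      open ≡-Reasoning
      regroup : ∀ a b c → a + b + (b + c) ≡ a + 2 * b + c
      regroup = solve-∀

    pairing-monoʳ : ∀ f {g h} → (∀ z → g z ≤ h z) → pairing f g ≤ pairing f h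
    pairing-monoʳ f g≤h = ∑-mono λ y → ∑-mono λ z → *-monoʳ-≤ (f y) (*-monoˡ-≤ (adjℕ y z) (g≤h z))

    pairing-one : ∀ {r} → (∀ y → deg G y ≡ r) → ∀ f → pairing f (λ _ → 1) ≡ sum f * r
    pairing-one {r} regular f = begin
      ∑[ y < n ] ∑[ z < n ] (f y * (1 * adjℕ y z))
        ≡⟨ sum-cong-≗ (λ y → sum-cong-≗ (λ z → cong (f y *_) (*-identityˡ (adjℕ y z)))) ⟩
      ∑[ y < n ] ∑[ z < n ] (f y * adjℕ y z)
        ≡⟨ sum-cong-≗ (λ y → *-distribˡ-sum (f y) (adjℕ y)) ⟨
      ∑[ y < n ] (f y * ∑[ z < n ] adjℕ y z)
        ≡⟨ sum-cong-≗ (λ y → cong (f y *_) (trans (sym (deg≡∑ y)) (regular y))) ⟩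
      ∑[ y < n ] (f y * r)
        ≡⟨ *-distribʳ-sum r f ⟨
      sum f * r ∎
      where open ≡-Reasoning

    -- Each y is adjacent to at most (∑ f) − f y of the weight, since y ≁ y.
    pairing-self-≤ : ∀ f → pairing f f ≤ sum f * (sum f ∸ 1)
    pairing-self-≤ f = begin
      pairing f f
        ≡⟨ sum-cong-≗ (λ y → *-distribˡ-sum (f y) (λ z → f z * adjℕ y z)) ⟨
      ∑[ y < n ] (f y * ∑[ z < n ] (f z * adjℕ y z))
        ≤⟨ ∑-mono (λ y → *-monoʳ-≤ (f y) (∑-mono-except f (λ z → f z * adjℕ y z) y
                    (trans (cong (f y *_) (adjℕ-irrefl y)) (*-zeroʳ (f y)))
                    (λ z → *-χ-≤ (f z) (adj G y z)))) ⟩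
      ∑[ y < n ] (f y * (sum f ∸ f y))
        ≤⟨ ∑-mono (λ y → *-∸-≤ (f y) (sum f)) ⟩
      ∑[ y < n ] (f y * (sum f ∸ 1))
        ≡⟨ *-distribʳ-sum (sum f ∸ 1) f ⟨
      sum f * (sum f ∸ 1) ∎
      where open ≤-Reasoning

    pairing-neighbourhood : ∀ x → pairing (adjℕ x) (adjℕ x) ≡ 2 * K3deg G x
    pairing-neighbourhood x = trans (∑∑-symmetric f f-sym f-diag) (cong (2 *_) (sym (K3deg≡∑ x)))
      where
      f : Fin n → Fin n → ℕ
      f y z = adjℕ x y * (adjℕ x z * adjℕ y z)
      f-sym : ∀ y z → f y z ≡ f z y
      f-sym y z = trans (x∙yz≈y∙xz (adjℕ x y) (adjℕ x z) (adjℕ y z)) (cong (λ e → adjℕ x z * (adjℕ x y * e)) (adjℕ-sym y z))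
      f-diag : ∀ y → f y y ≡ 0
      f-diag y rewrite adjℕ-irrefl y | *-zeroʳ (adjℕ x y) = *-zeroʳ (adjℕ x y)

    -- Indicators of N(u) ∩ N(v), of N(u) ∖ N(v) (which contains v when u ~ v) and of N(u) ∖ N[v].
    module _ (u v : Fin n) where
      common only only⁻ : Fin n → ℕ
      common y = χ (adj G u y ∧ adj G v y)
      only   y = χ (adj G u y ∧ not (adj G v y))
      only⁻  y = χ (adj G u y ∧ not (adj G v y) ∧ not (does (y ≟ᶠ v)))

    adjℕ-split : ∀ u v y → adjℕ u y ≡ common u v y + only u v y
    adjℕ-split u v y with adj G u y | adj G v y
    ... | true  | true  = refl
    ... | true  | false = refl
    ... | false | _     = refl

    common-comm : ∀ u v y → common u v y ≡ common v u y
    common-comm u v y = cong χ (∧-comm (adj G u y) (adj G v y))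

    adjℕ-split′ : ∀ u v y → adjℕ v y ≡ common u v y + only v u y
    adjℕ-split′ u v y = trans (adjℕ-split v u y) (cong (_+ only v u y) (common-comm v u y))

    common+only+only≤1 : ∀ u v y → common u v y + only u v y + only v u y ≤ 1
    common+only+only≤1 u v y with adj G u y | adj G v y
    ... | true  | true  = ≤-refl
    ... | true  | false = ≤-refl
    ... | false | true  = ≤-refl
    ... | false | false = z≤n

    only-split : ∀ {u v} → Adj G u v → ∀ y → only u v y ≡ χ (does (y ≟ᶠ v)) + only⁻ u v y
    only-split {u} {v} u~v y with y ≟ᶠ v
    ... | yes refl rewrite u~v | adj-irrfl G v = refl
    ... | no _ with adj G u y | adj G v y
    ...   | true  | true  = refl
    ...   | true  | false = refl
    ...   | false | _     = refl

    only-⊥-v : ∀ u v z → only u v z * adjℕ v z ≡ 0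
    only-⊥-v u v z with adj G u z | adj G v z
    ... | true  | true  = refl
    ... | true  | false = refl
    ... | false | _     = refl

    -- v has no neighbour in N(u) ∖ N(v), so dropping v from the left argument changes nothing.
    pairing-only : ∀ {u v} → Adj G u v → ∀ g → (∀ z → g z ≤ only u v z) →
      pairing (only u v) g ≡ pairing (only⁻ u v) g
    pairing-only {u} {v} u~v g g≤only = sum-cong-≗ λ y → sum-cong-≗ λ z → pointwise y z (y ≟ᶠ v)
      where
      g-⊥-v : ∀ z → g z * adjℕ v z ≡ 0
      g-⊥-v z = n≤0⇒n≡0 (≤-trans (*-monoˡ-≤ (adjℕ v z) (g≤only z)) (≤-reflexive (only-⊥-v u v z)))
      pointwise : ∀ y z → Dec (y ≡ v) → only u v y * (g z * adjℕ y z) ≡ only⁻ u v y * (g z * adjℕ y z)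
      pointwise y z (yes refl) rewrite g-⊥-v z = trans (*-zeroʳ (only u v y)) (sym (*-zeroʳ (only⁻ u v y)))
      pointwise y z (no y≢v) = cong (_* (g z * adjℕ y z))
        (trans (only-split u~v y) (cong (λ b → χ b + only⁻ u v y) (dec-false (y ≟ᶠ v) y≢v)))

    pairing-only-only : ∀ {u v} → Adj G u v → pairing (only u v) (only u v) ≡ pairing (only⁻ u v) (only⁻ u v)
    pairing-only-only {u} {v} u~v = begin
      pairing (only u v) (only u v)     ≡⟨ pairing-only u~v (only u v) (λ _ → ≤-refl) ⟩
      pairing (only⁻ u v) (only u v)    ≡⟨ pairing-comm (only⁻ u v) (only u v) ⟩
      pairing (only u v) (only⁻ u v)    ≡⟨ pairing-only u~v (only⁻ u v) only⁻≤only ⟩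
      pairing (only⁻ u v) (only⁻ u v)   ∎
      where
      open ≡-Reasoning
      only⁻≤only : ∀ z → only⁻ u v z ≤ only u v z
      only⁻≤only z = ≤-trans (m≤n+m (only⁻ u v z) _) (≤-reflexive (sym (only-split u~v z)))

    pairing-only-self-≤ : ∀ {u v} → Adj G u v →
      let m = sum (only⁻ u v) in pairing (only u v) (only u v) ≤ m * (m ∸ 1)
    pairing-only-self-≤ u~v = ≤-trans (≤-reflexive (pairing-only-only u~v)) (pairing-self-≤ _)

    K3degE≡∑ : ∀ u v → K3degE G u v ≡ sum (common u v)
    K3degE≡∑ u v = trans (length-filter-tabulate (λ y → isTrue (adj G u y ∧ adj G v y)) (λ y → y))
                         (sum-cong-≗ (λ y → χ-isTrue (adj G u y ∧ adj G v y)))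

    deg-split : ∀ {u v} → Adj G u v → deg G u ≡ sum (common u v) + suc (sum (only⁻ u v))
    deg-split {u} {v} u~v = begin
      deg G u
        ≡⟨ deg≡∑ u ⟩
      sum (adjℕ u)
        ≡⟨ sum-cong-≗ (adjℕ-split u v) ⟩
      ∑[ y < n ] (common u v y + only u v y)
        ≡⟨ ∑-distrib-+ (common u v) (only u v) ⟩
      sum (common u v) + sum (only u v)
        ≡⟨ cong (sum (common u v) +_) (sum-cong-≗ (only-split u~v)) ⟩
      sum (common u v) + ∑[ y < n ] (χ (does (y ≟ᶠ v)) + only⁻ u v y)
        ≡⟨ cong (sum (common u v) +_) (∑-distrib-+ (λ y → χ (does (y ≟ᶠ v))) (only⁻ u v)) ⟩
      sum (common u v) + (∑[ y < n ] χ (does (y ≟ᶠ v)) + sum (only⁻ u v))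
        ≡⟨ cong (λ t → sum (common u v) + (t + sum (only⁻ u v))) (∑-δ v) ⟩
      sum (common u v) + suc (sum (only⁻ u v)) ∎
      where open ≡-Reasoning

    sum-only⁻-comm : ∀ {u v} → Adj G u v → deg G u ≡ deg G v → sum (only⁻ v u) ≡ sum (only⁻ u v)
    sum-only⁻-comm {u} {v} u~v deg-u≡deg-v = suc-injective (+-cancelˡ-≡ (sum (common u v)) _ _ (begin
      sum (common u v) + suc (sum (only⁻ v u))   ≡⟨ cong (_+ suc (sum (only⁻ v u))) (sum-cong-≗ (common-comm u v)) ⟩
      sum (common v u) + suc (sum (only⁻ v u))   ≡⟨ deg-split (trans (adj-sym G v u) u~v) ⟨
      deg G v                                    ≡⟨ deg-u≡deg-v ⟨
      deg G u                                    ≡⟨ deg-split u~v ⟩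
      sum (common u v) + suc (sum (only⁻ u v))   ∎))
      where open ≡-Reasoning

    pairing-squares : ∀ f g h →
      pairing (λ y → f y + g y) (λ y → f y + g y) + pairing (λ y → f y + h y) (λ y → f y + h y)
      ≡ 2 * pairing f (λ y → f y + g y + h y) + pairing g g + pairing h h
    pairing-squares f g h = begin
      pairing (λ y → f y + g y) (λ y → f y + g y) + pairing (λ y → f y + h y) (λ y → f y + h y)
        ≡⟨ cong₂ _+_ (pairing-square f g) (pairing-square f h) ⟩
      (pairing f f + 2 * pairing f g + pairing g g) + (pairing f f + 2 * pairing f h + pairing h h)
        ≡⟨ regroup (pairing f f) (pairing f g) (pairing f h) (pairing g g) (pairing h h) ⟩
      2 * (pairing f f + pairing f g + pairing f h) + pairing g g + pairing h h
        ≡⟨ cong (λ t → 2 * t + pairing g g + pairing h h) (sym (trans (pairing-distribʳ f (λ y → f y + g y) h)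
                                                             (cong (_+ pairing f h) (pairing-distribʳ f f g)))) ⟩
      2 * pairing f (λ y → f y + g y + h y) + pairing g g + pairing h h ∎
      where
      open ≡-Reasoning
      regroup : ∀ a b c d e → (a + 2 * b + d) + (a + 2 * c + e) ≡ 2 * (a + b + c) + d + e
      regroup = solve-∀

    edge-bound : ∀ {r₂ r₃ u v} → HasParams G r₂ r₃ → Adj G u v →
      let m = sum (only⁻ u v) in 2 * r₃ ≤ sum (common u v) * r₂ + m * (m ∸ 1)
    edge-bound {r₂} {r₃} {u} {v} params u~v = *-cancelˡ-≤ 2 (begin
      2 * (2 * r₃)
        ≡⟨ cong (2 * r₃ +_) (+-identityʳ (2 * r₃)) ⟩
      2 * r₃ + 2 * r₃
        ≡⟨ cong₂ _+_ (cong (2 *_) (proj₂ (params u))) (cong (2 *_) (proj₂ (params v))) ⟨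
      2 * K3deg G u + 2 * K3deg G v
        ≡⟨ cong₂ _+_ (pairing-neighbourhood u) (pairing-neighbourhood v) ⟨
      pairing (adjℕ u) (adjℕ u) + pairing (adjℕ v) (adjℕ v)
        ≡⟨ cong₂ _+_ (pairing-cong (adjℕ-split u v) (adjℕ-split u v)) (pairing-cong (adjℕ-split′ u v) (adjℕ-split′ u v)) ⟩
      pairing (λ y → c y + p y) (λ y → c y + p y) + pairing (λ y → c y + q y) (λ y → c y + q y)
        ≡⟨ pairing-squares c p q ⟩
      2 * pairing c (λ y → c y + p y + q y) + pairing p p + pairing q q
        ≤⟨ +-mono-≤ (+-mono-≤ (*-monoʳ-≤ 2 (pairing-monoʳ c (common+only+only≤1 u v))) (pairing-only-self-≤ u~v))
                    (pairing-only-self-≤ v~u) ⟩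
      2 * pairing c (λ _ → 1) + m * (m ∸ 1) + m′ * (m′ ∸ 1)
        ≡⟨ cong₂ (λ s t → 2 * s + m * (m ∸ 1) + t * (t ∸ 1)) (pairing-one (proj₁ ∘ params) c) m′≡m ⟩
      2 * (sum c * r₂) + m * (m ∸ 1) + m * (m ∸ 1)
        ≡⟨ double (sum c * r₂) (m * (m ∸ 1)) ⟩
      2 * (sum c * r₂ + m * (m ∸ 1)) ∎)
      where
      open ≤-Reasoning
      c p q : Fin n → ℕ
      c = common u v
      p = only u v
      q = only v u
      m m′ : ℕ
      m = sum (only⁻ u v)
      m′ = sum (only⁻ v u)
      v~u : Adj G v u
      v~u = trans (adj-sym G v u) u~v
      m′≡m : m′ ≡ m
      m′≡m = sum-only⁻-comm u~v (trans (proj₁ (params u)) (sym (proj₁ (params v))))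
      double : ∀ a b → 2 * a + b + b ≡ 2 * (a + b)
      double = solve-∀

    regular-edge-bound : ∀ {r₂ r₃ k u v} → HasParams G r₂ r₃ → Adj G u v → K3degE G u v ≡ k →
      Σ[ m ∈ ℕ ] (r₂ ≡ k + suc m × 2 * r₃ ≤ k * r₂ + m * (m ∸ 1))
    regular-edge-bound {r₂} {r₃} {k} {u} {v} params u~v K3degE≡k =
      sum (only⁻ u v) , trans (sym (proj₁ (params u))) (trans (deg-split u~v) (cong (_+ _) ∑common≡k))
                      , subst (λ t → 2 * r₃ ≤ t * r₂ + _) ∑common≡k (edge-bound params u~v)
      where
      ∑common≡k : sum (common u v) ≡ k
      ∑common≡k = trans (sym (K3degE≡∑ u v)) K3degE≡k

open TriangleCounting using (regular-edge-bound)

open import Data.Nat as ℕ using (ℕ; zero; suc)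
open import Data.Fin using (Fin)
open import Data.Integer using (+_; _+_; _-_; _*_; _≤_; +≤+)
open import Data.Integer.Properties using (pos-+; pos-*; module ≤-Reasoning)
open import Data.Integer.Tactic.RingSolver using (solve-∀)
open import Data.Product using (_,_)
open import Relation.Binary.PropositionalEquality using (_≡_; refl; trans; cong; cong₂)

pos-*-pred : ∀ m → + (m ℕ.* (m ℕ.∸ 1)) ≡ + m * (+ m - + 1)
pos-*-pred zero    = refl
pos-*-pred (suc m) = pos-* (suc m) m

integer-form : ∀ {r₂} r₃ k m → r₂ ≡ k ℕ.+ suc m → 2 ℕ.* r₃ ℕ.≤ k ℕ.* r₂ ℕ.+ m ℕ.* (m ℕ.∸ 1) →
  + 2 * + r₃ ≤ (+ r₂ - + k - + 1) * (+ r₂ - + 2) + + k * (+ k + + 1)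
integer-form r₃ k m refl 2r₃≤ = begin
  + 2 * + r₃
    ≡⟨ pos-* 2 r₃ ⟨
  + (2 ℕ.* r₃)
    ≤⟨ +≤+ 2r₃≤ ⟩
  + (k ℕ.* r₂ ℕ.+ m ℕ.* (m ℕ.∸ 1))
    ≡⟨ trans (pos-+ (k ℕ.* r₂) _) (cong₂ _+_ (pos-* k r₂) (pos-*-pred m)) ⟩
  + k * + r₂ + + m * (+ m - + 1)
    ≡⟨ cong (λ x → + k * x + + m * (+ m - + 1)) (pos-+ k (suc m)) ⟩
  + k * (+ k + (+ 1 + + m)) + + m * (+ m - + 1)
    ≡⟨ expand (+ k) (+ m) ⟩
  (+ k + (+ 1 + + m) - + k - + 1) * (+ k + (+ 1 + + m) - + 2) + + k * (+ k + + 1)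
    ≡⟨ cong (λ x → (x - + k - + 1) * (x - + 2) + + k * (+ k + + 1)) (pos-+ k (suc m)) ⟨
  (+ r₂ - + k - + 1) * (+ r₂ - + 2) + + k * (+ k + + 1) ∎
  where
  open ≤-Reasoning
  r₂ : ℕ
  r₂ = k ℕ.+ suc m
  expand : ∀ K M → K * (K + (+ 1 + M)) + M * (M - + 1)
                 ≡ (K + (+ 1 + M) - K - + 1) * (K + (+ 1 + M) - + 2) + K * (K + + 1)
  expand = solve-∀

lemma3p4 : ∀ {n} (G : SimpleGraph n) (r₂ r₃ k : ℕ) → HasParams G r₂ r₃ →
    (u v : Fin n) → Adj G u v → K3degE G u v ≡ k →
    + 2 * + r₃ ≤ (+ r₂ - + k - + 1) * (+ r₂ - + 2) + + k * (+ k + + 1)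
lemma3p4 G r₂ r₃ k params u v u~v K3degE≡k with regular-edge-bound G params u~v K3degE≡k
... | m , r₂≡k+1+m , 2r₃≤ = integer-form r₃ k m r₂≡k+1+m 2r₃≤
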